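{- Let $A=\mathbb{F}_p\langle X_1,\ldots,X_d\rangle$ be graded by $\deg^\tau X_i=\tau_i$ for positive integers $\tau_1,\ldots,\tau_d$, and let $\mathfrak{M}$ be the set of monomials in $A$ (including $1$). Let $<$ be any total order on $X=\{X_1,\ldots,X_d\}$ and $U\subseteq X$ any subset. Then the relation $<_U$ on $\mathfrak{M}$ defined below is a multiplicative order, i.e. a total order on $\mathfrak{M}$ such that $1<_U\alpha$ for all $1\ne\alpha\in\mathfrak{M}$ and such that $\alpha<_U\alpha'$ implies $\beta\alpha\gamma<_U\beta\alpha'\gamma$ for all $\beta,\gamma\in\mathfrak{M}$.
   Context: For a monomial $\alpha=X_{i_1}\cdots X_{i_{n}}$ let $\deg^\tau\alpha=\tau_{i_1}+\ldots+\tau_{i_n}$, let $l^U(\alpha)=\#\{k\in\{1,\ldots,n\}: X_{i_k}\notin U\}$, and let $k^U(\alpha)=\sum_{1\le k\le n,\ X_{i_k}\notin U}\deg^\tau(X_{i_1}\cdots X_{i_k})$. The lexicographic order $<'$ induced by $<$ is: $X_{i_1}\cdots X_{i_l}<'X_{j_1}\cdots X_{j_k}$ iff $l<k$, or $l=k$ and for some $n_0$ one has $X_{i_n}=X_{j_n}$ for $n<n_0$ and $X_{i_{n_0}}<X_{j_{n_0}}$. Define $\alpha<_U\alpha'$ iff (i) $\deg^\tau\alpha<\deg^\tau\alpha'$, or (ii) $\deg^\tau\alpha=\deg^\tau\alpha'$ and $l^U(\alpha)<l^U(\alpha')$, or (iii) $\deg^\tau\alpha=\deg^\tau\alpha'$,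 $l^U(\alpha)=l^U(\alpha')$ and $k^U(\alpha)<k^U(\alpha')$, or (iv) $\deg^\tau\alpha=\deg^\tau\alpha'$, $l^U(\alpha)=l^U(\alpha')$, $k^U(\alpha)=k^U(\alpha')$ and $\alpha<'\alpha'$. -}

module Defs where

open import Level using (0ℓ)
open import Data.Nat using (ℕ; zero; suc; _+_; _<_)
open import Data.Bool using (Bool; true; false; if_then_else_)
open import Data.Fin using (Fin)
open import Data.Fin.Subset using (Subset)
open import Data.Vec using (lookup)
open import Data.List using (List; []; _∷_; _++_; length)
open import Data.Product using (_×_)
open import Data.Sum using (_⊎_)
open import Data.Empty using (⊥)
open import Relation.Binary.Core using (Rel)
open import Relation.Binary.Structures using (IsStrictTotalOrder)
open import Relation.Binary.PropositionalEquality using (_≡_; _≢_)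

-- Monomials in the free algebra F_p<X_1,...,X_d>: words in the variables
-- X_i, encoded as lists of indices i : Fin d.  The empty word is 1.
Monomial : ℕ → Set
Monomial d = List (Fin d)

one : ∀ {d} → Monomial d
one = []

module _ {d : ℕ} (τ : Fin d → ℕ) where

  degτ : Monomial d → ℕ
  degτ []       = 0
  degτ (i ∷ is) = τ i + degτ is

  module _ (U : Subset d) where
    lU : Monomial d → ℕ
    lU []       = 0
    lU (i ∷ is) = (if lookup U i then 0 else 1) + lU is

    -- auxiliary: acc = deg^τ of the prefix already read
    kU-acc : ℕ → Monomial d → ℕ
    kU-acc acc []       = 0
    kU-acc acc (i ∷ is) =
      (if lookup U i then 0 else (acc + τ i)) + kU-acc (acc + τ i) is

    -- k^U(α) = Σ_{k : X_{i_k} ∉ U} deg^τ(X_{i_1} ... X_{i_k})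
    kU : Monomial d → ℕ
    kU = kU-acc 0

module _ {d : ℕ} (_<X_ : Rel (Fin d) 0ℓ) where

  -- first differing letter is smaller (for words of equal length)
  LexFirst : Monomial d → Monomial d → Set
  LexFirst []       _        = ⊥
  LexFirst (_ ∷ _)  []       = ⊥
  LexFirst (i ∷ is) (j ∷ js) = (i <X j) ⊎ ((i ≡ j) × LexFirst is js)

  _<′_ : Rel (Monomial d) 0ℓ
  α <′ β = (length α < length β) ⊎ ((length α ≡ length β) × LexFirst α β)

OrdU : ∀ {d} → (τ : Fin d → ℕ) → (_<X_ : Rel (Fin d) 0ℓ) → (U : Subset d) →
       Rel (Monomial d) 0ℓ
OrdU τ _<X_ U α α′ =
  (degτ τ α < degτ τ α′)
  ⊎ ((degτ τ α ≡ degτ τ α′) × (lU τ U α < lU τ U α′))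
  ⊎ ((degτ τ α ≡ degτ τ α′) × (lU τ U α ≡ lU τ U α′) × (kU τ U α < kU τ U α′))
  ⊎ ((degτ τ α ≡ degτ τ α′) × (lU τ U α ≡ lU τ U α′) × (kU τ U α ≡ kU τ U α′)
     × (_<′_ _<X_ α α′))

record IsMultiplicativeOrder {d : ℕ} (_≺_ : Rel (Monomial d) 0ℓ) : Set where
  field
    isStrictTotalOrder : IsStrictTotalOrder _≡_ _≺_
    one-least          : ∀ (α : Monomial d) → α ≢ one → one ≺ α
    compatible         : ∀ (α α′ β γ : Monomial d) → α ≺ α′ →
                         (β ++ α ++ γ) ≺ (β ++ α′ ++ γ)

module Submission where

open import Defs
open import Level using (0ℓ)
open import Data.Nat using (ℕ; _<_; _+_; _*_; suc)
open import Data.Nat.Properties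
  using (<-isStrictTotalOrder; +-monoˡ-<; +-assoc; +-comm; +-identityʳ; *-zeroʳ;
         suc-injective; <-≤-trans; m≤m+n)
open import Data.Nat.Tactic.RingSolver using (solve-∀)
open import Data.Fin using (Fin)
open import Data.Fin.Subset using (Subset)
open import Data.Bool using (true; false; if_then_else_)
open import Data.Vec using (lookup)
open import Data.List using ([]; _∷_; _++_; length)
open import Data.List.Properties using (length-++)
open import Data.Product using (_×_; _,_)
open import Data.Sum using (_⊎_; inj₁; inj₂)
open import Data.Empty using (⊥-elim)
open import Function using (_∘_)
open import Relation.Nullary using (¬_)
open import Relation.Binary.Core using (Rel)
open import Relation.Binary.Definitions using (Tri; tri<; tri≈; tri>)
open import Relation.Binary.Structures using (IsStrictTotalOrder)
open import Relation.Binary.PropositionalEquality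

-- The order <_U compares monomials by a chain of keys
-- deg^τ, l^U, k^U, length, and finally the first differing letter.
-- (1) Refining a relation R by a key f (compare keys first, break ties
--     by R) gives a strict total order as soon as R is irreflexive,
--     transitive and trichotomous on each fibre of f.  The first-letter
--     comparison is trichotomous on words of equal length, so <' is a
--     strict total order, and three further refinements give <_U.
-- (2) Multiplying by a fixed monomial on either side shifts deg^τ, l^U and
--     the length by constants, and shifts k^U by an amount depending only
--     on deg^τ and l^U, because k^U(αγ) = k^U(α) + deg^τ(α) l^U(γ) + k^U(γ).
--     Such a translation preserves <_U: each tie-break is consulted only
--     when the earlier keys agree.
-- (3) 1 is least because deg^τ α > 0 for α ≠ 1, all τ_i being positive.

isStrictTotalOrder-⇔ : ∀ {A : Set} {R S : Rel A 0ℓ} →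
  (∀ {a b} → R a b → S a b) → (∀ {a b} → S a b → R a b) →
  IsStrictTotalOrder _≡_ S → IsStrictTotalOrder _≡_ R
isStrictTotalOrder-⇔ {R = R} {S} to from S-order = record
  { isStrictPartialOrder = record
    { isEquivalence = isEquivalence
    ; irrefl        = λ eq → S-order.irrefl eq ∘ to
    ; trans         = λ r r′ → from (S-order.trans (to r) (to r′))
    ; <-resp-≈      = resp₂ R
    }
  ; compare = λ a b → transport (S-order.compare a b)
  }
  where
  module S-order = IsStrictTotalOrder S-order
  transport : ∀ {a b} → Tri (S a b) (a ≡ b) (S b a) → Tri (R a b) (a ≡ b) (R b a)
  transport (tri< s ¬eq ¬s′) = tri< (from s) ¬eq (¬s′ ∘ to)
  transport (tri≈ ¬s eq ¬s′) = tri≈ (¬s ∘ to) eq (¬s′ ∘ to)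
  transport (tri> ¬s ¬eq s′) = tri> (¬s ∘ to) ¬eq (from s′)

module Refinement {A K : Set} {_<ₖ_ : Rel K 0ℓ}
                  (keyOrder : IsStrictTotalOrder _≡_ _<ₖ_) (key : A → K) where
  private module Key = IsStrictTotalOrder keyOrder

  Refine : Rel A 0ℓ → Rel A 0ℓ
  Refine R a b = (key a <ₖ key b) ⊎ (key a ≡ key b × R a b)

  refine-isStrictTotalOrder : ∀ {R : Rel A 0ℓ} →
    (∀ {a} → ¬ R a a) → (∀ {a b c} → R a b → R b c → R a c) →
    (∀ a b → key a ≡ key b → Tri (R a b) (a ≡ b) (R b a)) →
    IsStrictTotalOrder _≡_ (Refine R)
  refine-isStrictTotalOrder {R} R-irrefl R-trans R-compare = record
    { isStrictPartialOrder = record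
      { isEquivalence = isEquivalence
      ; irrefl        = λ { refl → refine-irrefl }
      ; trans         = refine-trans
      ; <-resp-≈      = resp₂ (Refine R)
      }
    ; compare = refine-compare
    }
    where
    not-refine : ∀ {a b} → ¬ (key a <ₖ key b) → (key a ≡ key b → ¬ R a b) →
                 ¬ Refine R a b
    not-refine ¬k< _  (inj₁ k<)       = ¬k< k<
    not-refine _   ¬r (inj₂ (k≡ , r)) = ¬r k≡ r

    refine-irrefl : ∀ {a} → ¬ Refine R a a
    refine-irrefl = not-refine (Key.irrefl refl) (λ _ → R-irrefl)

    refine-trans : ∀ {a b c} → Refine R a b → Refine R b c → Refine R a c
    refine-trans (inj₁ k<)        (inj₁ k<′)        = inj₁ (Key.trans k< k<′)
    refine-trans {a} (inj₁ k<)    (inj₂ (k≡ , _))   = inj₁ (subst (key a <ₖ_) k≡ k<)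
    refine-trans {c = c} (inj₂ (k≡ , _)) (inj₁ k<′) = inj₁ (subst (_<ₖ key c) (sym k≡) k<′)
    refine-trans (inj₂ (k≡ , r))  (inj₂ (k≡′ , r′)) = inj₂ (trans k≡ k≡′ , R-trans r r′)

    refine-compare : ∀ a b → Tri (Refine R a b) (a ≡ b) (Refine R b a)
    refine-compare a b with Key.compare (key a) (key b)
    ... | tri< k< k≢ ¬k> = tri< (inj₁ k<) (k≢ ∘ cong key) (not-refine ¬k> (λ k≡ _ → k≢ (sym k≡)))
    ... | tri> ¬k< k≢ k> = tri> (not-refine ¬k< (λ k≡ _ → k≢ k≡)) (k≢ ∘ cong key) (inj₁ k>)
    ... | tri≈ ¬k< k≡ ¬k> with R-compare a b k≡
    ...   | tri< r ¬eq ¬r′ = tri< (inj₂ (k≡ , r)) ¬eq (not-refine ¬k> (λ _ → ¬r′))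
    ...   | tri≈ ¬r eq ¬r′ = tri≈ (not-refine ¬k< (λ _ → ¬r)) eq (not-refine ¬k> (λ _ → ¬r′))
    ...   | tri> ¬r ¬eq r′ = tri> (not-refine ¬k< (λ _ → ¬r)) ¬eq (inj₂ (sym k≡ , r′))

  refine-strictTotalOrder : ∀ {R : Rel A 0ℓ} →
    IsStrictTotalOrder _≡_ R → IsStrictTotalOrder _≡_ (Refine R)
  refine-strictTotalOrder R-order =
    refine-isStrictTotalOrder (R.irrefl refl) R.trans (λ a b _ → R.compare a b)
    where module R = IsStrictTotalOrder R-order

module _ {d : ℕ} {_<X_ : Rel (Fin d) 0ℓ} (letterOrder : IsStrictTotalOrder _≡_ _<X_) where
  private
    module X = IsStrictTotalOrder letterOrder
    LF = LexFirst _<X_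

  lexFirst-irrefl : ∀ {α} → ¬ LF α α
  lexFirst-irrefl {_ ∷ _} (inj₁ i<i)     = X.irrefl refl i<i
  lexFirst-irrefl {_ ∷ _} (inj₂ (_ , r)) = lexFirst-irrefl r

  lexFirst-trans : ∀ {α β γ} → LF α β → LF β γ → LF α γ
  lexFirst-trans {_ ∷ _} {_ ∷ _} {_ ∷ _} (inj₁ i<j)        (inj₁ j<k)         = inj₁ (X.trans i<j j<k)
  lexFirst-trans {_ ∷ _} {_ ∷ _} {_ ∷ _} (inj₁ i<j)        (inj₂ (refl , _))  = inj₁ i<j
  lexFirst-trans {_ ∷ _} {_ ∷ _} {_ ∷ _} (inj₂ (refl , _)) (inj₁ j<k)         = inj₁ j<k
  lexFirst-trans {_ ∷ _} {_ ∷ _} {_ ∷ _} (inj₂ (refl , r)) (inj₂ (refl , r′)) =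
    inj₂ (refl , lexFirst-trans r r′)

  lexFirst-compare : ∀ α β → length α ≡ length β → Tri (LF α β) (α ≡ β) (LF β α)
  lexFirst-compare []      []      _ = tri≈ (λ ()) refl (λ ())
  lexFirst-compare (i ∷ α) (j ∷ β) same-length with X.compare i j
  ... | tri< i<j i≢j ¬j<i = tri< (inj₁ i<j) (λ { refl → i≢j refl })
                              λ { (inj₁ j<i) → ¬j<i j<i ; (inj₂ (j≡i , _)) → i≢j (sym j≡i) }
  ... | tri> ¬i<j i≢j j<i = tri> (λ { (inj₁ i<j) → ¬i<j i<j ; (inj₂ (i≡j , _)) → i≢j i≡j })
                              (λ { refl → i≢j refl }) (inj₁ j<i)
  ... | tri≈ ¬i<j refl ¬j<i with lexFirst-compare α β (suc-injective same-length)
  ...   | tri< r α≢β ¬r′ = tri< (inj₂ (refl , r)) (λ { refl → α≢β refl })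
                             λ { (inj₁ j<i) → ¬j<i j<i ; (inj₂ (_ , r′)) → ¬r′ r′ }
  ...   | tri≈ _ refl _  = tri≈ lexFirst-irrefl refl lexFirst-irrefl
  ...   | tri> ¬r α≢β r′ = tri> (λ { (inj₁ i<j) → ¬i<j i<j ; (inj₂ (_ , r)) → ¬r r })
                             (λ { refl → α≢β refl }) (inj₂ (refl , r′))

  <′-isStrictTotalOrder : IsStrictTotalOrder _≡_ (_<′_ _<X_)
  <′-isStrictTotalOrder =
    refine-isStrictTotalOrder lexFirst-irrefl lexFirst-trans lexFirst-compare
    where open Refinement <-isStrictTotalOrder length

degτ-++ : ∀ {d} (τ : Fin d → ℕ) α β → degτ τ (α ++ β) ≡ degτ τ α + degτ τ β
degτ-++ τ []      β = refl
degτ-++ τ (i ∷ α) β =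
  trans (cong (τ i +_) (degτ-++ τ α β)) (sym (+-assoc (τ i) (degτ τ α) (degτ τ β)))

module _ {d : ℕ} (τ : Fin d → ℕ) (U : Subset d) where
  private
    D = degτ τ
    L = lU τ U
    K = kU τ U
    Kacc = kU-acc τ U
    right-comm : ∀ a b c → a + b + c ≡ a + c + b
    right-comm = solve-∀

  lU-++ : ∀ α β → L (α ++ β) ≡ L α + L β
  lU-++ []      β = refl
  lU-++ (i ∷ α) β = trans (cong (c +_) (lU-++ α β)) (sym (+-assoc c (L α) (L β)))
    where c = if lookup U i then 0 else 1

  -- Raising the starting degree by s raises each of the l^U(α) summands of
  -- k^U by s.
  kU-acc-shift : ∀ acc s α → Kacc (acc + s) α ≡ s * L α + Kacc acc α
  kU-acc-shift acc s [] = sym (cong (_+ 0) (*-zeroʳ s))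
  kU-acc-shift acc s (i ∷ α) with lookup U i
  ... | true  = trans (cong (λ a → Kacc a α) (right-comm acc s (τ i)))
                      (kU-acc-shift (acc + τ i) s α)
  ... | false = begin
      acc + s + τ i + Kacc (acc + s + τ i) α
    ≡⟨ cong (λ a → acc + s + τ i + Kacc a α) (right-comm acc s (τ i)) ⟩
      acc + s + τ i + Kacc (acc + τ i + s) α
    ≡⟨ cong (acc + s + τ i +_) (kU-acc-shift (acc + τ i) s α) ⟩
      acc + s + τ i + (s * L α + Kacc (acc + τ i) α)
    ≡⟨ regroup acc s (τ i) (L α) (Kacc (acc + τ i) α) ⟩
      s * suc (L α) + (acc + τ i + Kacc (acc + τ i) α)
    ∎
    where open ≡-Reasoning
          regroup : ∀ a s t l k → a + s + t + (s * l + k) ≡ s * suc l + (a + t + k)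
          regroup = solve-∀

  kU-acc-++ : ∀ acc α β → Kacc acc (α ++ β) ≡ Kacc acc α + Kacc (acc + D α) β
  kU-acc-++ acc []      β = cong (λ a → Kacc a β) (sym (+-identityʳ acc))
  kU-acc-++ acc (i ∷ α) β = begin
      c + Kacc (acc + τ i) (α ++ β)
    ≡⟨ cong (c +_) (kU-acc-++ (acc + τ i) α β) ⟩
      c + (Kacc (acc + τ i) α + Kacc (acc + τ i + D α) β)
    ≡⟨ sym (+-assoc c _ _) ⟩
      c + Kacc (acc + τ i) α + Kacc (acc + τ i + D α) β
    ≡⟨ cong (λ a → c + Kacc (acc + τ i) α + Kacc a β) (+-assoc acc (τ i) (D α)) ⟩
      c + Kacc (acc + τ i) α + Kacc (acc + (τ i + D α)) β
    ∎
    where open ≡-Reasoning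
          c = if lookup U i then 0 else (acc + τ i)

  kU-++ : ∀ α β → K (α ++ β) ≡ K α + (D α * L β + K β)
  kU-++ α β = trans (kU-acc-++ 0 α β) (cong (K α +_) (kU-acc-shift 0 (D α) β))

shift-< : ∀ {x y x′ y′ c c′ : ℕ} → x′ ≡ x + c → y′ ≡ y + c′ → c ≡ c′ → x < y → x′ < y′
shift-< refl refl refl x<y = +-monoˡ-< _ x<y

shift-≡ : ∀ {x y x′ y′ c c′ : ℕ} → x′ ≡ x + c → y′ ≡ y + c′ → c ≡ c′ → x ≡ y → x′ ≡ y′
shift-≡ refl refl refl refl = refl

module Translations {d : ℕ} (τ : Fin d → ℕ) (_<X_ : Rel (Fin d) 0ℓ) (U : Subset d) where
  private
    D = degτ τ
    L = lU τ U
    K = kU τ U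
    LF = LexFirst _<X_
    _<U_ = OrdU τ _<X_ U

  lexFirst-++ʳ : ∀ {α β} γ → LF α β → LF (α ++ γ) (β ++ γ)
  lexFirst-++ʳ {_ ∷ _} {_ ∷ _} γ (inj₁ i<j)       = inj₁ i<j
  lexFirst-++ʳ {_ ∷ _} {_ ∷ _} γ (inj₂ (i≡j , r)) = inj₂ (i≡j , lexFirst-++ʳ γ r)

  lexFirst-++ˡ : ∀ {α β} γ → LF α β → LF (γ ++ α) (γ ++ β)
  lexFirst-++ˡ []      r = r
  lexFirst-++ˡ (_ ∷ γ) r = inj₂ (refl , lexFirst-++ˡ γ r)

  record IsTranslation (h : Monomial d → Monomial d) : Set where
    field
      degτ-shift lU-shift length-shift : ℕ
      kU-shift   : ℕ → ℕ → ℕ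
      degτ-h     : ∀ α → D (h α) ≡ D α + degτ-shift
      lU-h       : ∀ α → L (h α) ≡ L α + lU-shift
      kU-h       : ∀ α → K (h α) ≡ K α + kU-shift (D α) (L α)
      length-h   : ∀ α → length (h α) ≡ length α + length-shift
      lexFirst-h : ∀ {α β} → LF α β → LF (h α) (h β)

  -- Translations preserve <_U: at each level the earlier keys agree, so the
  -- shift of the current key is the same on both sides.
  translation-preserves : ∀ {h} → IsTranslation h → ∀ {α β} → α <U β → h α <U h β
  translation-preserves {h} T {α} {β} = preserve
    where
    open IsTranslation T
    deg≡ : D α ≡ D β → D (h α) ≡ D (h β)
    deg≡ = shift-≡ (degτ-h α) (degτ-h β) refl
    l≡ : L α ≡ L β → L (h α) ≡ L (h β)
    l≡ = shift-≡ (lU-h α) (lU-h β) refl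

    preserve-<′ : _<′_ _<X_ α β → _<′_ _<X_ (h α) (h β)
    preserve-<′ (inj₁ len<)       = inj₁ (shift-< (length-h α) (length-h β) refl len<)
    preserve-<′ (inj₂ (len≡ , r)) = inj₂ (shift-≡ (length-h α) (length-h β) refl len≡ , lexFirst-h r)

    preserve : α <U β → h α <U h β
    preserve (inj₁ D<) = inj₁ (shift-< (degτ-h α) (degτ-h β) refl D<)
    preserve (inj₂ (inj₁ (D≡ , L<))) = inj₂ (inj₁ (deg≡ D≡ , shift-< (lU-h α) (lU-h β) refl L<))
    preserve (inj₂ (inj₂ (inj₁ (D≡ , L≡ , K<)))) = inj₂ (inj₂ (inj₁
      (deg≡ D≡ , l≡ L≡ , shift-< (kU-h α) (kU-h β) (cong₂ kU-shift D≡ L≡) K<)))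
    preserve (inj₂ (inj₂ (inj₂ (D≡ , L≡ , K≡ , lex)))) = inj₂ (inj₂ (inj₂
      (deg≡ D≡ , l≡ L≡ , shift-≡ (kU-h α) (kU-h β) (cong₂ kU-shift D≡ L≡) K≡ , preserve-<′ lex)))

  right-translation : ∀ γ → IsTranslation (_++ γ)
  right-translation γ = record
    { kU-shift   = λ deg l → deg * L γ + K γ
    ; degτ-h     = λ α → degτ-++ τ α γ
    ; lU-h       = λ α → lU-++ τ U α γ
    ; kU-h       = λ α → kU-++ τ U α γ
    ; length-h   = λ α → length-++ α
    ; lexFirst-h = lexFirst-++ʳ γ
    }

  left-translation : ∀ β → IsTranslation (β ++_)
  left-translation β = record
    { kU-shift   = λ deg l → K β + D β * l
    ; degτ-h     = λ α → trans (degτ-++ τ β α) (+-comm (D β) (D α))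
    ; lU-h       = λ α → trans (lU-++ τ U β α) (+-comm (L β) (L α))
    ; kU-h       = λ α → trans (kU-++ τ U β α) (rotate (K β) (D β * L α) (K α))
    ; length-h   = λ α → trans (length-++ β) (+-comm (length β) (length α))
    ; lexFirst-h = lexFirst-++ˡ β
    }
    where rotate : ∀ a b c → a + (b + c) ≡ c + (a + b)
          rotate = solve-∀

OrdU-isStrictTotalOrder : ∀ {d} (τ : Fin d → ℕ) {_<X_ : Rel (Fin d) 0ℓ} →
  IsStrictTotalOrder _≡_ _<X_ → (U : Subset d) → IsStrictTotalOrder _≡_ (OrdU τ _<X_ U)
OrdU-isStrictTotalOrder {d} τ {_<X_} letterOrder U =
  isStrictTotalOrder-⇔ to-nested from-nested
    (ByDeg.refine-strictTotalOrder (ByL.refine-strictTotalOrder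
      (ByK.refine-strictTotalOrder (<′-isStrictTotalOrder letterOrder))))
  where
  module ByDeg = Refinement <-isStrictTotalOrder (degτ τ)
  module ByL   = Refinement <-isStrictTotalOrder (lU τ U)
  module ByK   = Refinement <-isStrictTotalOrder (kU τ U)

  Nested : Rel (Monomial d) 0ℓ
  Nested = ByDeg.Refine (ByL.Refine (ByK.Refine (_<′_ _<X_)))

  to-nested : ∀ {α β} → OrdU τ _<X_ U α β → Nested α β
  to-nested (inj₁ D<)                                 = inj₁ D<
  to-nested (inj₂ (inj₁ (D≡ , L<)))                   = inj₂ (D≡ , inj₁ L<)
  to-nested (inj₂ (inj₂ (inj₁ (D≡ , L≡ , K<))))       = inj₂ (D≡ , inj₂ (L≡ , inj₁ K<))
  to-nested (inj₂ (inj₂ (inj₂ (D≡ , L≡ , K≡ , lex)))) = inj₂ (D≡ , inj₂ (L≡ , inj₂ (K≡ , lex)))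

  from-nested : ∀ {α β} → Nested α β → OrdU τ _<X_ U α β
  from-nested (inj₁ D<)                                 = inj₁ D<
  from-nested (inj₂ (D≡ , inj₁ L<))                     = inj₂ (inj₁ (D≡ , L<))
  from-nested (inj₂ (D≡ , inj₂ (L≡ , inj₁ K<)))         = inj₂ (inj₂ (inj₁ (D≡ , L≡ , K<)))
  from-nested (inj₂ (D≡ , inj₂ (L≡ , inj₂ (K≡ , lex)))) = inj₂ (inj₂ (inj₂ (D≡ , L≡ , K≡ , lex)))

degτ-positive : ∀ {d} (τ : Fin d → ℕ) → (∀ i → 0 < τ i) → ∀ α → α ≢ one → 0 < degτ τ α
degτ-positive τ τ-pos []      α≢1 = ⊥-elim (α≢1 refl)
degτ-positive τ τ-pos (i ∷ α) _   = <-≤-trans (τ-pos i) (m≤m+n (τ i) (degτ τ α))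

lemma3p7 : (d : ℕ) (τ : Fin d → ℕ) → (∀ i → 0 < τ i) →
    (_<X_ : Rel (Fin d) 0ℓ) → IsStrictTotalOrder _≡_ _<X_ →
    (U : Subset d) →
    IsMultiplicativeOrder (OrdU τ _<X_ U)
lemma3p7 d τ τ-pos _<X_ letterOrder U = record
  { isStrictTotalOrder = OrdU-isStrictTotalOrder τ letterOrder U
  ; one-least          = λ α α≢1 → inj₁ (degτ-positive τ τ-pos α α≢1)
  ; compatible         = λ α α′ β γ α<α′ →
      translation-preserves (left-translation β)
        (translation-preserves (right-translation γ) α<α′)
  }
  where open Translations τ _<X_ U
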